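{- Let $d_1,\dots,d_k\in\{1,\dots,5\}$ and let $Y_1,\dots,Y_6$ be as described in the context. Then \[ \max\{\mathrm{Ht}(Y_2),\mathrm{Ht}(Y_5)\}\le\min\{\mathrm{Ht}(Y_3),\mathrm{Ht}(Y_4)\}. \]
   Context: Let $M_1=\begin{pmatrix}-3&1&4\\-4&-1&4\\-6&0&7\end{pmatrix}$, $M_2=\begin{pmatrix}4&1&4\\3&-1&4\\6&0&7\end{pmatrix}$, $M_3=\begin{pmatrix}4&3&4\\3&4&4\\6&6&7\end{pmatrix}$, $M_4=\begin{pmatrix}-1&3&4\\1&4&4\\0&6&7\end{pmatrix}$, $M_5=\begin{pmatrix}-1&-4&4\\1&-3&4\\0&-6&7\end{pmatrix}$. Let $\mathbf{u}_1=(1,0,1)$, $\mathbf{u}_2=(5,3,7)$, $\mathbf{u}_3=(8,7,13)$, $\mathbf{u}_4=(7,8,13)$, $\mathbf{u}_5=(3,5,7)$, $\mathbf{u}_6=(0,1,1)$ (column vectors), $\mathbf{y}_j=M_{d_1}\cdots M_{d_k}\mathbf{u}_j$, and $Y_j$ the point $(y_{j,1}/y_{j,3},y_{j,2}/y_{j,3})$ represented by $\mathbf{y}_j=(y_{j,1},y_{j,2},y_{j,3})$; these are rational points on $\{x^2+xy+y^2=1,\ x,y\ge0\}$. For such a rational point $Z=(a/c,b/c)$ with $a,b,c$ coprime nonnegative integers and $c>0$, $\mathrm{Ht}(Z)=c$. -}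

module Defs where

open import Data.Nat using (ℕ; zero; suc)
open import Data.Nat.DivMod using (_/_)
open import Data.Nat.GCD using (gcd)
open import Data.Integer using (ℤ; +_; -[1+_]; _+_; _*_; ∣_∣)
open import Data.Fin using (Fin; zero; suc)
open import Data.List using (List; foldr)
open import Data.Product using (_×_; _,_)

Vec3 : Set
Vec3 = ℤ × ℤ × ℤ

Mat3 : Set
Mat3 = Vec3 × Vec3 × Vec3

dot : Vec3 → Vec3 → ℤ
dot (a , b , c) (x , y , z) = a * x + b * y + c * z

_·_ : Mat3 → Vec3 → Vec3
(r₁ , r₂ , r₃) · v = dot r₁ v , dot r₂ v , dot r₃ v

n : ℕ → ℤ
n k = -[1+ k ]   -- n k = -(k+1)

p : ℕ → ℤ
p k = + k

M₁ M₂ M₃ M₄ M₅ : Mat3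
M₁ = (n 2 , p 1 , p 4) , (n 3 , n 0 , p 4) , (n 5 , p 0 , p 7)
M₂ = (p 4 , p 1 , p 4) , (p 3 , n 0 , p 4) , (p 6 , p 0 , p 7)
M₃ = (p 4 , p 3 , p 4) , (p 3 , p 4 , p 4) , (p 6 , p 6 , p 7)
M₄ = (n 0 , p 3 , p 4) , (p 1 , p 4 , p 4) , (p 0 , p 6 , p 7)
M₅ = (n 0 , n 3 , p 4) , (p 1 , n 2 , p 4) , (p 0 , n 5 , p 7)

-- digit d ∈ {1,…,5} is represented by Fin 5 (zero ↦ 1, …, 4 ↦ 5)
M : Fin 5 → Mat3
M zero = M₁
M (suc zero) = M₂
M (suc (suc zero)) = M₃
M (suc (suc (suc zero))) = M₄
M (suc (suc (suc (suc zero)))) = M₅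

u₁ u₂ u₃ u₄ u₅ u₆ : Vec3
u₁ = p 1 , p 0 , p 1
u₂ = p 5 , p 3 , p 7
u₃ = p 8 , p 7 , p 13
u₄ = p 7 , p 8 , p 13
u₅ = p 3 , p 5 , p 7
u₆ = p 0 , p 1 , p 1

y : List (Fin 5) → Vec3 → Vec3
y ds u = foldr (λ d v → M d · v) u ds

-- Height of the point (y₁/y₃, y₂/y₃) represented by (y₁,y₂,y₃):
-- the denominator c of the reduced representative (a/c, b/c) with a,b,c
-- coprime, i.e. c = |y₃| / gcd(|y₁|,|y₂|,|y₃|).  (Value 0 in the
-- degenerate case of the zero vector, which does not occur.)
Ht : Vec3 → ℕ
Ht (a , b , c) with gcd ∣ a ∣ (gcd ∣ b ∣ ∣ c ∣)
... | zero = 0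
... | suc g = ∣ c ∣ / suc g

module Submission where

-- Write Y(u) = M_{d₁} ⋯ M_{d_k} u.  Every M_d has an integer
-- inverse, so Y preserves primitivity: if a row vector s has s·u = 1 then
-- some row vector s' has s'·Y(u) = 1.  The height of a primitive vector is
-- the absolute value of its third coordinate, so for the primitive
-- u₂, u₃, u₄, u₅ we get Ht(Y(uᵢ)) = |Y(uᵢ)₃|.
--
-- Positivity comes from an invariant cone: the cone C spanned by seven
-- explicit rays w₀ … w₆ of the upper half-space is mapped into itself by
-- every M_d (a table of nonnegative certificates), hence by Y, and all of
-- its vectors have nonnegative third coordinate.  Now u₂ and u₅ lie in C,
-- and u₃ − u₂, u₃ − u₅, u₄ − u₂, u₄ − u₅ are rays of C; by linearity of Y
-- the third coordinate of Y(u₃) or Y(u₄) is that of Y(u₂) or Y(u₅) plus a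
-- nonnegative number, which gives the four inequalities of the theorem.

open import Defs
open import Data.Nat using (ℕ; _≤_; _⊔_; _⊓_; z≤n)
open import Data.Fin using (Fin; zero; suc)
open import Data.List using (List; []; _∷_)

open import Data.Nat.Properties using (m≤m+n; ⊔-lub; ⊓-glb; module ≤-Reasoning)
open import Data.Nat.GCD using (gcd; gcd[m,n]∣m; gcd[m,n]∣n)
open import Data.Nat.Divisibility using (∣-trans; ∣1⇒≡1) renaming (_∣_ to _∣ℕ_)
open import Data.Nat.DivMod using (n/1≡n)
open import Data.Integer using (ℤ; +_; _+_; _*_; ∣_∣; +≤+; 0ℤ; 1ℤ)
  renaming (_≤_ to _≤ℤ_)
open import Data.Integer.Properties using (+-mono-≤; pos-*)
open import Data.Integer.Divisibility.Signed using (∣ᵤ⇒∣; ∣⇒∣ᵤ; ∣m∣n⇒∣m+n; ∣n⇒∣m*n)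
  renaming (_∣_ to _∣ℤ_)
open import Data.Integer.Tactic.RingSolver using (solve-∀)
open import Data.Product using (Σ; _,_)
open import Relation.Binary.PropositionalEquality
  using (_≡_; refl; sym; trans; cong; cong₂; subst; module ≡-Reasoning)

add : Vec3 → Vec3 → Vec3
add (a , b , c) (x , y , z) = a + x , b + y , c + z

scale : ℕ → Vec3 → Vec3
scale k (a , b , c) = + k * a , + k * b , + k * c

third : Vec3 → ℤ
third (a , b , c) = c

rowmul : Vec3 → Mat3 → Vec3
rowmul (a , b , c) ((m₁₁ , m₁₂ , m₁₃) , (m₂₁ , m₂₂ , m₂₃) , (m₃₁ , m₃₂ , m₃₃)) =
  a * m₁₁ + b * m₂₁ + c * m₃₁ , a * m₁₂ + b * m₂₂ + c * m₃₂ , a * m₁₃ + b * m₂₃ + c * m₃₃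

matmul : Mat3 → Mat3 → Mat3
matmul (r₁ , r₂ , r₃) B = rowmul r₁ B , rowmul r₂ B , rowmul r₃ B

identity : Mat3
identity = (p 1 , p 0 , p 0) , (p 0 , p 1 , p 0) , (p 0 , p 0 , p 1)

dot-add : ∀ r v w → dot r (add v w) ≡ dot r v + dot r w
dot-add (a , b , c) (x , y , z) (x' , y' , z') = expansion a b c x y z x' y' z'
  where
  expansion : ∀ a b c x y z x' y' z' →
    a * (x + x') + b * (y + y') + c * (z + z') ≡ (a * x + b * y + c * z) + (a * x' + b * y' + c * z')
  expansion = solve-∀

dot-scale : ∀ r k v → dot r (scale k v) ≡ + k * dot r v
dot-scale (a , b , c) k (x , y , z) = expansion (+ k) a b c x y z
  where
  expansion : ∀ k a b c x y z → a * (k * x) + b * (k * y) + c * (k * z) ≡ k * (a * x + b * y + c * z)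
  expansion = solve-∀

dot-rowmul : ∀ r A v → dot (rowmul r A) v ≡ dot r (A · v)
dot-rowmul (a , b , c) ((m₁₁ , m₁₂ , m₁₃) , (m₂₁ , m₂₂ , m₂₃) , (m₃₁ , m₃₂ , m₃₃)) (x , y , z) =
  expansion a b c m₁₁ m₁₂ m₁₃ m₂₁ m₂₂ m₂₃ m₃₁ m₃₂ m₃₃ x y z
  where
  expansion : ∀ a b c m₁₁ m₁₂ m₁₃ m₂₁ m₂₂ m₂₃ m₃₁ m₃₂ m₃₃ x y z →
    (a * m₁₁ + b * m₂₁ + c * m₃₁) * x + (a * m₁₂ + b * m₂₂ + c * m₃₂) * y + (a * m₁₃ + b * m₂₃ + c * m₃₃) * z
    ≡ a * (m₁₁ * x + m₁₂ * y + m₁₃ * z) + b * (m₂₁ * x + m₂₂ * y + m₂₃ * z) + c * (m₃₁ * x + m₃₂ * y + m₃₃ * z)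
  expansion = solve-∀

·-add : ∀ A v w → A · add v w ≡ add (A · v) (A · w)
·-add (r₁ , r₂ , r₃) v w = cong₂ _,_ (dot-add r₁ v w) (cong₂ _,_ (dot-add r₂ v w) (dot-add r₃ v w))

·-scale : ∀ A k v → A · scale k v ≡ scale k (A · v)
·-scale (r₁ , r₂ , r₃) k v = cong₂ _,_ (dot-scale r₁ k v) (cong₂ _,_ (dot-scale r₂ k v) (dot-scale r₃ k v))

·-assoc : ∀ A B v → A · (B · v) ≡ matmul A B · v
·-assoc (r₁ , r₂ , r₃) B v =
  sym (cong₂ _,_ (dot-rowmul r₁ B v) (cong₂ _,_ (dot-rowmul r₂ B v) (dot-rowmul r₃ B v)))

identity-· : ∀ v → identity · v ≡ v
identity-· (x , y , z) = cong₂ _,_ (first x y z) (cong₂ _,_ (second x y z) (last x y z))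
  where
  first : ∀ x y z → + 1 * x + + 0 * y + + 0 * z ≡ x
  first = solve-∀
  second : ∀ x y z → + 0 * x + + 1 * y + + 0 * z ≡ y
  second = solve-∀
  last : ∀ x y z → + 0 * x + + 0 * y + + 1 * z ≡ z
  last = solve-∀

y-add : ∀ ds v w → y ds (add v w) ≡ add (y ds v) (y ds w)
y-add []       v w = refl
y-add (d ∷ ds) v w = trans (cong (M d ·_) (y-add ds v w)) (·-add (M d) (y ds v) (y ds w))

-- v is unimodular when some integer row vector s has s·v = 1
-- (equivalently, the entries of v are coprime).
Unimodular : Vec3 → Set
Unimodular v = Σ Vec3 λ s → dot s v ≡ 1ℤ

unimodular-divisor : ∀ {a b c g} → Unimodular (a , b , c) →
  g ∣ℕ ∣ a ∣ → g ∣ℕ ∣ b ∣ → g ∣ℕ ∣ c ∣ → g ≡ 1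
unimodular-divisor {a} {b} {c} {g} ((s₁ , s₂ , s₃) , s·v≡1) g∣a g∣b g∣c =
  ∣1⇒≡1 (∣⇒∣ᵤ (subst (+ g ∣ℤ_) s·v≡1 g∣s·v))
  where
  g∣s·v : + g ∣ℤ dot (s₁ , s₂ , s₃) (a , b , c)
  g∣s·v = ∣m∣n⇒∣m+n (∣m∣n⇒∣m+n (∣n⇒∣m*n s₁ (∣ᵤ⇒∣ g∣a)) (∣n⇒∣m*n s₂ (∣ᵤ⇒∣ g∣b))) (∣n⇒∣m*n s₃ (∣ᵤ⇒∣ g∣c))

Ht-coprime : ∀ a b c → gcd ∣ a ∣ (gcd ∣ b ∣ ∣ c ∣) ≡ 1 → Ht (a , b , c) ≡ ∣ c ∣
Ht-coprime a b c gcd≡1 rewrite gcd≡1 = n/1≡n ∣ c ∣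

Ht-unimodular : ∀ {v} → Unimodular v → Ht v ≡ ∣ third v ∣
Ht-unimodular {a , b , c} unimodular = Ht-coprime a b c gcd≡1
  where
  gcd≡1 : gcd ∣ a ∣ (gcd ∣ b ∣ ∣ c ∣) ≡ 1
  gcd≡1 = unimodular-divisor unimodular
    (gcd[m,n]∣m ∣ a ∣ _)
    (∣-trans (gcd[m,n]∣n ∣ a ∣ _) (gcd[m,n]∣m ∣ b ∣ ∣ c ∣))
    (∣-trans (gcd[m,n]∣n ∣ a ∣ _) (gcd[m,n]∣n ∣ b ∣ ∣ c ∣))

-- A matrix with an integral left inverse maps unimodular vectors to
-- unimodular vectors: pull the witness row back through the inverse.
unimodular-image : ∀ A B → (∀ v → B · (A · v) ≡ v) → ∀ {v} → Unimodular v → Unimodular (A · v)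
unimodular-image A B left-inverse {v} (s , s·v≡1) = rowmul s B , (begin
  dot (rowmul s B) (A · v) ≡⟨ dot-rowmul s B (A · v) ⟩
  dot s (B · (A · v))      ≡⟨ cong (dot s) (left-inverse v) ⟩
  dot s v                  ≡⟨ s·v≡1 ⟩
  1ℤ                       ∎)
  where open ≡-Reasoning

pattern d₁ = zero
pattern d₂ = suc zero
pattern d₃ = suc (suc zero)
pattern d₄ = suc (suc (suc zero))
pattern d₅ = suc (suc (suc (suc zero)))

M⁻¹ : Fin 5 → Mat3
M⁻¹ d₁ = (n 6 , n 6 , p 8) , (p 4 , p 3 , n 3) , (n 5 , n 5 , p 7)
M⁻¹ d₂ = (p 7 , p 7 , n 7) , (n 2 , n 3 , p 4) , (n 5 , n 5 , p 7)
M⁻¹ d₃ = (p 4 , p 3 , n 3) , (p 3 , p 4 , n 3) , (n 5 , n 5 , p 7)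
M⁻¹ d₄ = (n 3 , n 2 , p 4) , (p 7 , p 7 , n 7) , (n 5 , n 5 , p 7)
M⁻¹ d₅ = (p 3 , p 4 , n 3) , (n 6 , n 6 , p 8) , (n 5 , n 5 , p 7)

M⁻¹-M : ∀ d → matmul (M⁻¹ d) (M d) ≡ identity
M⁻¹-M d₁ = refl
M⁻¹-M d₂ = refl
M⁻¹-M d₃ = refl
M⁻¹-M d₄ = refl
M⁻¹-M d₅ = refl

M-left-inverse : ∀ d v → M⁻¹ d · (M d · v) ≡ v
M-left-inverse d v = begin
  M⁻¹ d · (M d · v)        ≡⟨ ·-assoc (M⁻¹ d) (M d) v ⟩
  matmul (M⁻¹ d) (M d) · v ≡⟨ cong (_· v) (M⁻¹-M d) ⟩
  identity · v             ≡⟨ identity-· v ⟩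
  v                        ∎
  where open ≡-Reasoning

y-unimodular : ∀ ds {u} → Unimodular u → Unimodular (y ds u)
y-unimodular []       unimodular = unimodular
y-unimodular (d ∷ ds) unimodular =
  unimodular-image (M d) (M⁻¹ d) (M-left-inverse d) (y-unimodular ds unimodular)

data Ray : Set where
  w₀ w₁ w₂ w₃ w₄ w₅ w₆ : Ray

W : Ray → Vec3
W w₀ = p 1 , p 0 , p 1
W w₁ = p 5 , p 2 , p 6
W w₂ = p 2 , p 5 , p 6
W w₃ = p 0 , p 1 , p 1
W w₄ = p 5 , p 3 , p 7
W w₅ = p 3 , p 4 , p 6
W w₆ = p 4 , p 3 , p 6

infixr 5 _⊕_
infix  6 _⊛_

data Cone : Vec3 → Set where
  ray : ∀ r → Cone (W r)
  _⊕_ : ∀ {v w} → Cone v → Cone w → Cone (add v w)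
  _⊛_ : ∀ k {v} → Cone v → Cone (scale k v)

third-nonneg : ∀ {v} → Cone v → 0ℤ ≤ℤ third v
third-nonneg (ray w₀) = +≤+ z≤n
third-nonneg (ray w₁) = +≤+ z≤n
third-nonneg (ray w₂) = +≤+ z≤n
third-nonneg (ray w₃) = +≤+ z≤n
third-nonneg (ray w₄) = +≤+ z≤n
third-nonneg (ray w₅) = +≤+ z≤n
third-nonneg (ray w₆) = +≤+ z≤n
third-nonneg (c ⊕ c') = +-mono-≤ (third-nonneg c) (third-nonneg c')
third-nonneg (k ⊛ c) = nonneg-multiple k (third-nonneg c)
  where
  nonneg-multiple : ∀ k {x} → 0ℤ ≤ℤ x → 0ℤ ≤ℤ + k * x
  nonneg-multiple k {+ m} _ = subst (0ℤ ≤ℤ_) (pos-* k m) (+≤+ z≤n)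

cone-image : ∀ A → (∀ r → Cone (A · W r)) → ∀ {v} → Cone v → Cone (A · v)
cone-image A rays (ray r) = rays r
cone-image A rays (_⊕_ {v} {w} c c') =
  subst Cone (sym (·-add A v w)) (cone-image A rays c ⊕ cone-image A rays c')
cone-image A rays (_⊛_ k {v} c) =
  subst Cone (sym (·-scale A k v)) (k ⊛ cone-image A rays c)

M-ray : ∀ d r → Cone (M d · W r)
M-ray d₁ w₀ = ray w₀
M-ray d₁ w₁ = 6 ⊛ ray w₀ ⊕ ray w₁
M-ray d₁ w₂ = 3 ⊛ ray w₀ ⊕ ray w₁ ⊕ 3 ⊛ ray w₄
M-ray d₁ w₃ = ray w₄
M-ray d₁ w₄ = 6 ⊛ ray w₀ ⊕ ray w₁ ⊕ ray w₄
M-ray d₁ w₅ = 4 ⊛ ray w₀ ⊕ ray w₁ ⊕ 2 ⊛ ray w₄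
M-ray d₁ w₆ = 5 ⊛ ray w₀ ⊕ ray w₁ ⊕ ray w₄
M-ray d₂ w₀ = ray w₄ ⊕ ray w₅
M-ray d₂ w₁ = 6 ⊛ ray w₄ ⊕ 4 ⊛ ray w₅ ⊕ ray w₆
M-ray d₂ w₂ = 6 ⊛ ray w₄ ⊕ ray w₅ ⊕ ray w₆
M-ray d₂ w₃ = ray w₄
M-ray d₂ w₄ = 7 ⊛ ray w₄ ⊕ 4 ⊛ ray w₅ ⊕ ray w₆
M-ray d₂ w₅ = 6 ⊛ ray w₄ ⊕ 2 ⊛ ray w₅ ⊕ ray w₆
M-ray d₂ w₆ = 6 ⊛ ray w₄ ⊕ 3 ⊛ ray w₅ ⊕ ray w₆
M-ray d₃ w₀ = ray w₄ ⊕ ray w₅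
M-ray d₃ w₁ = ray w₂ ⊕ 6 ⊛ ray w₄ ⊕ 6 ⊛ ray w₅
M-ray d₃ w₂ = 4 ⊛ ray w₂ ⊕ 6 ⊛ ray w₄ ⊕ 3 ⊛ ray w₅
M-ray d₃ w₃ = ray w₂ ⊕ ray w₄
M-ray d₃ w₄ = 2 ⊛ ray w₂ ⊕ 7 ⊛ ray w₄ ⊕ 6 ⊛ ray w₅
M-ray d₃ w₅ = 3 ⊛ ray w₂ ⊕ 6 ⊛ ray w₄ ⊕ 4 ⊛ ray w₅
M-ray d₃ w₆ = 2 ⊛ ray w₂ ⊕ 6 ⊛ ray w₄ ⊕ 5 ⊛ ray w₅
M-ray d₄ w₀ = ray w₃ ⊕ ray w₅
M-ray d₄ w₁ = 5 ⊛ ray w₂ ⊕ 3 ⊛ ray w₃ ⊕ 3 ⊛ ray w₄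
M-ray d₄ w₂ = 6 ⊛ ray w₂ ⊕ ray w₃ ⊕ 5 ⊛ ray w₄
M-ray d₄ w₃ = ray w₂ ⊕ ray w₄
M-ray d₄ w₄ = 6 ⊛ ray w₂ ⊕ 3 ⊛ ray w₃ ⊕ 4 ⊛ ray w₄
M-ray d₄ w₅ = 5 ⊛ ray w₂ ⊕ 2 ⊛ ray w₃ ⊕ 4 ⊛ ray w₄ ⊕ ray w₅
M-ray d₄ w₆ = 4 ⊛ ray w₂ ⊕ 3 ⊛ ray w₃ ⊕ 3 ⊛ ray w₄ ⊕ 2 ⊛ ray w₅
M-ray d₅ w₀ = ray w₃ ⊕ ray w₅
M-ray d₅ w₁ = 3 ⊛ ray w₂ ⊕ 5 ⊛ ray w₃ ⊕ ray w₄
M-ray d₅ w₂ = ray w₂ ⊕ 6 ⊛ ray w₃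
M-ray d₅ w₃ = ray w₃
M-ray d₅ w₄ = 3 ⊛ ray w₂ ⊕ 6 ⊛ ray w₃ ⊕ ray w₄
M-ray d₅ w₅ = ray w₂ ⊕ 6 ⊛ ray w₃ ⊕ ray w₅
M-ray d₅ w₆ = ray w₂ ⊕ 6 ⊛ ray w₃ ⊕ 2 ⊛ ray w₅

y-cone : ∀ ds {v} → Cone v → Cone (y ds v)
y-cone []       c = c
y-cone (d ∷ ds) c = cone-image (M d) (M-ray d) (y-cone ds c)

Ht-monotone : ∀ ds {u w} → Unimodular u → Unimodular (add u w) → Cone u → Cone w →
  Ht (y ds u) ≤ Ht (y ds (add u w))
Ht-monotone ds {u} {w} unimodular-u unimodular-u+w cone-u cone-w = begin
  Ht (y ds u)                         ≡⟨ Ht-unimodular (y-unimodular ds unimodular-u) ⟩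
  ∣ third (y ds u) ∣                  ≤⟨ ∣∣-+-nonneg (third-nonneg (y-cone ds cone-u))
                                                      (third-nonneg (y-cone ds cone-w)) ⟩
  ∣ third (y ds u) + third (y ds w) ∣ ≡⟨ cong (λ v → ∣ third v ∣) (y-add ds u w) ⟨
  ∣ third (y ds (add u w)) ∣          ≡⟨ Ht-unimodular (y-unimodular ds unimodular-u+w) ⟨
  Ht (y ds (add u w))                 ∎
  where
  open ≤-Reasoning
  ∣∣-+-nonneg : ∀ {a b} → 0ℤ ≤ℤ a → 0ℤ ≤ℤ b → ∣ a ∣ ≤ ∣ a + b ∣
  ∣∣-+-nonneg {+ m} {+ k} _ _ = m≤m+n m k

proposition2p13 : (ds : List (Fin 5)) →
    Ht (y ds u₂) ⊔ Ht (y ds u₅) ≤ Ht (y ds u₃) ⊓ Ht (y ds u₄)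
proposition2p13 ds = ⊔-lub (⊓-glb u₂≤u₃ u₂≤u₄) (⊓-glb u₅≤u₃ u₅≤u₄)
  where
  unimodular-u₂ : Unimodular u₂
  unimodular-u₂ = (n 0 , p 2 , p 0) , refl
  unimodular-u₃ : Unimodular u₃
  unimodular-u₃ = (p 1 , n 0 , p 0) , refl
  unimodular-u₄ : Unimodular u₄
  unimodular-u₄ = (n 0 , p 1 , p 0) , refl
  unimodular-u₅ : Unimodular u₅
  unimodular-u₅ = (p 2 , n 0 , p 0) , refl
  -- u₂ = w₄ and u₅ = w₀ + w₂ lie in C; u₃ = u₂ + w₅ = u₅ + w₁ and
  -- u₄ = u₂ + w₂ = u₅ + w₆.
  u₂≤u₃ : Ht (y ds u₂) ≤ Ht (y ds u₃)
  u₂≤u₃ = Ht-monotone ds unimodular-u₂ unimodular-u₃ (ray w₄) (ray w₅)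
  u₂≤u₄ : Ht (y ds u₂) ≤ Ht (y ds u₄)
  u₂≤u₄ = Ht-monotone ds unimodular-u₂ unimodular-u₄ (ray w₄) (ray w₂)
  u₅≤u₃ : Ht (y ds u₅) ≤ Ht (y ds u₃)
  u₅≤u₃ = Ht-monotone ds unimodular-u₅ unimodular-u₃ (ray w₀ ⊕ ray w₂) (ray w₁)
  u₅≤u₄ : Ht (y ds u₅) ≤ Ht (y ds u₄)
  u₅≤u₄ = Ht-monotone ds unimodular-u₅ unimodular-u₄ (ray w₀ ⊕ ray w₂) (ray w₆)
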